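{- Let $(a_i)$ be a representing sequence with $a_1=k$ whose representation word $w$ is strongly Fergusonian. Let $T=\{a_i-1\mid i\geq2\}\cup\{1,\dots,k-1\}$ and let $N$ be the set of non-volatile zends with respect to $(a_i)$. If $w$ is the Nim sequence of $T$, then $(N+T)\cap N=\emptyset$.
   Context: A representing sequence is a strictly increasing sequence $(a_i)_{i\ge0}$ of positive integers with $a_0=1$. For $n\ge1$ with $a_j\le n<a_{j+1}$, the $(a_i)$-representation of $n$ is $d_j\cdots d_0$ with $n=\sum d_ia_i$ and $\sum d_i$ minimal (greedy); the representation of $0$ is $0$. $n$ is a zend if its representation ends in $0$; $n\ge0$ is non-volatile if the representation of $n+1$ does not end in $0$, and $2$-volatile if it ends in at least two zeros. The representation word of $(a_i)$ is the word $w$ with $w[n]=a_1$ if $n$ is $2$-volatile and otherwise $w[n]$ is the last digit of the representation of $n$. A word over $\{0,\dots,k\}$ ($k\ge2$) is Fergusonian if for every $0\le i<k-1$ every $i$ is immediately followed by $i+1$ and every $i+1$ is immediately preceded by $i$; strongly Fergusonian if moreover no two consecutive letters are both $k$. $N+T=\{n+t\mid n\in N,t\in T\}$. For a set $S$ of positive integers, $\mathrm{SG}_S(n)=\mathrm{mex}\{\mathrm{SG}_S(n-s)\mid s\in S,s\le n\}$ and the Nim sequence of $S$ is $(\mathrm{SG}_S(n))_{n\ge0}$. -}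

module Defs where

open import Data.Nat using (ℕ; zero; suc; _+_; _∸_; _≤_; _<_; NonZero)
open import Data.Nat.DivMod using (_/_; _%_)
open import Data.Product using (Σ; ∃; _×_)
open import Data.Sum using (_⊎_)
open import Relation.Nullary using (¬_)
open import Relation.Binary.PropositionalEquality using (_≡_; _≢_)

record IsRepresentingSequence (a : ℕ → ℕ) : Set where
  field
    a₀≡1       : a 0 ≡ 1
    strictIncr : ∀ i → a i < a (suc i)

-- Division / remainder, total in the divisor (the divisor is never 0
-- for a representing sequence; the zero case is an irrelevant default).
_div′_ : ℕ → ℕ → ℕ
m div′ zero  = 0
m div′ suc d = m / suc d

_mod′_ : ℕ → ℕ → ℕ
m mod′ zero  = m
m mod′ suc d = m % suc d

-- Greedy algorithm: rem a n f i is what is left of n after greedily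
-- processing the indices i+f-1, i+f-2, ..., i (highest first).
rem : (ℕ → ℕ) → ℕ → ℕ → ℕ → ℕ
rem a n zero    i = n
rem a n (suc f) i = rem a n f (suc i) mod′ a i

-- The i-th digit of the greedy (a)-representation of n.  Processing the
-- indices up to i + n + 1 suffices since a j > n for j > n; digits beyond
-- the top of the representation are 0.
digit : (ℕ → ℕ) → ℕ → ℕ → ℕ
digit a n i = rem a n (suc n) (suc i) div′ a i

lastDigit : (ℕ → ℕ) → ℕ → ℕ
lastDigit a n = digit a n 0

Zend : (ℕ → ℕ) → ℕ → Set
Zend a n = lastDigit a n ≡ 0

NonVolatile : (ℕ → ℕ) → ℕ → Set
NonVolatile a n = lastDigit a (suc n) ≢ 0

TwoVolatile : (ℕ → ℕ) → ℕ → Set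
TwoVolatile a n = digit a (suc n) 0 ≡ 0 × digit a (suc n) 1 ≡ 0

IsRepresentationWord : (ℕ → ℕ) → (ℕ → ℕ) → Set
IsRepresentationWord a w =
  ∀ n → (TwoVolatile a n → w n ≡ a 1) × (¬ TwoVolatile a n → w n ≡ lastDigit a n)

record Fergusonian (k : ℕ) (w : ℕ → ℕ) : Set where
  field
    k≥2       : 2 ≤ k
    alphabet  : ∀ n → w n ≤ k
    followed  : ∀ i → suc i < k → ∀ n → w n ≡ i → w (suc n) ≡ suc i
    preceded  : ∀ i → suc i < k → ∀ n → w n ≡ suc i →
                Σ ℕ (λ m → n ≡ suc m × w m ≡ i)

record StronglyFergusonian (k : ℕ) (w : ℕ → ℕ) : Set where
  field
    fergusonian : Fergusonian k w
    noKK        : ∀ n → ¬ (w n ≡ k × w (suc n) ≡ k)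

InT : (ℕ → ℕ) → ℕ → ℕ → Set
InT a k s = Σ ℕ (λ i → 2 ≤ i × s ≡ a i ∸ 1) ⊎ (1 ≤ s × s < k)

IsMex : (ℕ → Set) → ℕ → Set
IsMex P m = ¬ P m × (∀ j → j < m → P j)

-- w is the Nim sequence of the subtraction set S:
-- w n = mex { w (n - s) | s ∈ S, s ≤ n } for all n
-- (this recursion uniquely determines SG_S, so w = SG_S).
IsNimSequence : (ℕ → Set) → (ℕ → ℕ) → Set
IsNimSequence S w =
  ∀ n → IsMex (λ v → Σ ℕ (λ s → S s × s ≤ n × w (n ∸ s) ≡ v)) (w n)

InN : (ℕ → ℕ) → ℕ → Set
InN a n = Zend a n × NonVolatile a n

-- Every element of N carries the letter 0 in the representation word. If n and n + t were
-- both in N with t ∈ T, the position n + t would have the option n of the same Nim value 0,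
-- contradicting that a Nim value is the mex of the values of its options.
module Submission where

open import Defs
open import Data.Nat using (ℕ; _+_; _∸_; _≤_)
open import Data.Nat.Properties using (m+n∸n≡m; m≤n+m)
open import Data.Product using (Σ; _×_; _,_; proj₁; proj₂)
open import Relation.Nullary using (¬_)
open import Relation.Binary.PropositionalEquality using (_≡_; _≢_; sym; trans; cong)

-- A non-volatile n is not 2-volatile, so w n is the last digit of n.
representationWord-nonVolatileZend : ∀ a {w} → IsRepresentationWord a w →
                                     ∀ {n} → InN a n → w n ≡ 0
representationWord-nonVolatileZend a rw {n} (zend , nonVolatile) =
  trans (proj₂ (rw n) (λ twoVolatile → nonVolatile (proj₁ twoVolatile))) zend

nimSequence-option≢ : ∀ {S w} → IsNimSequence S w →
                      ∀ {m s} → S s → s ≤ m → w (m ∸ s) ≢ w m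
nimSequence-option≢ nim {m} {s} s∈S s≤m option≡ =
  proj₁ (nim m) (s , s∈S , s≤m , option≡)

proposition4p7 : (a : ℕ → ℕ) (k : ℕ) (w : ℕ → ℕ) →
    IsRepresentingSequence a → a 1 ≡ k →
    IsRepresentationWord a w → StronglyFergusonian k w →
    IsNimSequence (InT a k) w →
    ¬ Σ ℕ (λ n → Σ ℕ (λ t → InN a n × InT a k t × InN a (n + t)))
proposition4p7 a k w _ _ rw _ nim (n , t , n∈N , t∈T , n+t∈N) =
  nimSequence-option≢ nim t∈T (m≤n+m t n) option≡
  where
  option≡ : w (n + t ∸ t) ≡ w (n + t)
  option≡ = trans (cong w (m+n∸n≡m n t))
                  (trans (representationWord-nonVolatileZend a rw n∈N)
                         (sym (representationWord-nonVolatileZend a rw n+t∈N)))
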